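{- A permutation $\pi$ avoids the classical pattern $4312$ if and only if $(S\circ r\circ c\circ Q)(\pi)$ is the identity permutation (i.e. is sorted).
   Context: A permutation $\pi$ contains a classical pattern $p$ of length $k$ if there are indices $j_1<\dots<j_k$ such that $\pi_{j_1}\cdots\pi_{j_k}$ is order-isomorphic to $p$; otherwise it avoids $p$. For a permutation $\pi=\pi_1\cdots\pi_n$: the reverse is $r(\pi)=\pi_n\cdots\pi_1$; the complement is $c(\pi)=(n+1-\pi_1)\cdots(n+1-\pi_n)$. $S$ is the (unlimited depth) stack-sort operator: $S(\varepsilon)=\varepsilon$ and $S(\alpha n\beta)=S(\alpha)S(\beta)n$ where $n$ is the largest letter. $Q$ is queue-sorting: read the input letters $s$ left to right while maintaining a queue (a list ordered by insertion time; removal always takes the earliest-inserted element) and an output word. For each $s$: if the queue is empty or the most recently inserted element of the queue is smaller than $s$, insert $s$ into the queue; otherwise, repeatedly remove the earliest-inserted element of the queue and append it to the output as long as the queue is nonempty and that element is smaller than $s$, and then append $s$ to the output. After the input is exhausted, append the remaining queue elements to the output in insertion order. $Q(\pi)$ is the resulting output. The composition $S\circ r\circ c\circ Q$ applies $Q$ first. -}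

module Defs where

open import Data.Nat using (ℕ; zero; suc; _∸_; _<_; _<?_; _⊔_; _≟_)
open import Data.List using (List; []; _∷_; _++_; length; map; filter; reverse; upTo; foldr; span)
open import Data.List.Relation.Binary.Sublist.Propositional using (_⊆_)
open import Data.List.Relation.Binary.Permutation.Propositional using (_↭_)
open import Data.Product using (Σ; _×_; _,_)
open import Relation.Binary.PropositionalEquality using (_≡_)
open import Relation.Nullary using (¬_; ¬?; yes; no)
open import Relation.Nullary.Decidable using (does)
open import Data.Bool using (Bool; true; false; if_then_else_; not)

idPerm : ℕ → List ℕ
idPerm n = map suc (upTo n)

IsPerm : List ℕ → Set
IsPerm π = π ↭ idPerm (length π)

-- standardization (reduction) of a word with distinct letters:
-- each letter x is replaced by 1 + #(letters smaller than x)
red : List ℕ → List ℕ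
red σ = map (λ x → suc (length (filter (_<? x) σ))) σ

Contains : List ℕ → List ℕ → Set
Contains p π = Σ (List ℕ) (λ σ → (σ ⊆ π) × (red σ ≡ p))

Avoids : List ℕ → List ℕ → Set
Avoids p π = ¬ Contains p π

rev : List ℕ → List ℕ
rev = reverse

comp : List ℕ → List ℕ
comp π = map (λ x → suc (length π) ∸ x) π

maxL : List ℕ → ℕ
maxL = foldr _⊔_ 0

-- stack sort S(α n β) = S(α) S(β) n, n the largest letter.
-- Implemented with fuel; fuel = length suffices since α, β are strictly shorter.
stackSortF : ℕ → List ℕ → List ℕ
stackSortF zero    _  = []
stackSortF (suc k) [] = []
stackSortF (suc k) (x ∷ xs) with span (λ y → ¬? (y ≟ maxL (x ∷ xs))) (x ∷ xs)
... | (α , [])     = stackSortF k α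
... | (α , m ∷ β)  = stackSortF k α ++ stackSortF k β ++ (m ∷ [])

S : List ℕ → List ℕ
S π = stackSortF (length π) π

-- last element of a nonempty list (queue = list in insertion order; head = earliest)
lastLt : List ℕ → ℕ → Bool
lastLt []           s = false
lastLt (y ∷ [])     s = does (y <? s)
lastLt (y ∷ z ∷ ys) s = lastLt (z ∷ ys) s

drain : List ℕ → ℕ → List ℕ × List ℕ
drain []       s = [] , []
drain (y ∷ ys) s with does (y <? s)
... | false = [] , y ∷ ys
... | true  with drain ys s
...   | (out , rest) = y ∷ out , rest

queueStep : List ℕ → List ℕ → List ℕ → List ℕ
queueStep q out []       = out ++ q
queueStep [] out (s ∷ ss) = queueStep (s ∷ []) out ss
queueStep (y ∷ ys) out (s ∷ ss) with lastLt (y ∷ ys) s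
... | true  = queueStep ((y ∷ ys) ++ (s ∷ [])) out ss
... | false with drain (y ∷ ys) s
...   | (removed , rest) = queueStep rest (out ++ removed ++ (s ∷ [])) ss

Q : List ℕ → List ℕ
Q π = queueStep [] [] π

SrcQ : List ℕ → List ℕ
SrcQ π = S (rev (comp (Q π)))

pattern4312 : List ℕ
pattern4312 = 4 ∷ 3 ∷ 1 ∷ 2 ∷ []

module Submission where

open import Defs
open import Data.Bool using (true; false)
open import Data.List using (List; []; _∷_; _++_; length; map; filter; reverse; upTo; span)
open import Data.List.Properties
  using (++-assoc; ++-identityʳ; length-++; reverse-involutive; reverse-++; map-∘; map-++; map-upTo; upTo-∷ʳ)
open import Data.List.Membership.Propositional using (_∈_)
open import Data.List.Membership.Propositional.Properties using (∈-++⁺ˡ; ∈-++⁺ʳ; ∈-++⁻; ∈-map⁻; ∈-upTo⁻)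
open import Data.List.Relation.Unary.Any as Any using (here; there)
open import Data.List.Relation.Unary.All as All using (All; []; _∷_)
open import Data.List.Relation.Unary.AllPairs as AllPairs using (AllPairs; []; _∷_)
import Data.List.Relation.Unary.AllPairs.Properties as AllPairs
open import Data.List.Relation.Unary.Unique.Propositional using (Unique)
open import Data.List.Relation.Unary.Sorted.TotalOrder using (Sorted)
open import Data.List.Relation.Unary.Sorted.TotalOrder.Properties using (↗↭↗⇒≋)
import Data.List.Relation.Unary.Linked as Linked
open import Data.List.Relation.Unary.Linked.Properties using (AllPairs⇒Linked)
open import Data.List.Relation.Binary.Pointwise using (Pointwise-≡⇒≡)
open import Data.List.Relation.Unary.Unique.Propositional.Properties using (Unique[x∷xs]⇒x∉xs)
open import Data.List.Relation.Binary.Sublist.Propositional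
  using (_⊆_; []; _∷_; _∷ʳ_; ⊆-refl; ⊆-trans; minimum; from∈; to∈)
open import Data.List.Relation.Binary.Sublist.Propositional.Properties
  using (++⁺ˡ; ++⁺ʳ; ++⁺; ∷ˡ⁻; reverse⁺; map⁺; filter⁺; length-mono-≤; All-resp-⊆)
open import Data.List.Relation.Binary.Permutation.Propositional
  using (_↭_; ↭-refl; ↭-sym; ↭-trans; ↭-reflexive; ↭⇒↭ₛ; module PermutationReasoning)
import Data.List.Relation.Binary.Permutation.Propositional.Properties as Perm
import Data.List.Relation.Binary.Permutation.Setoid.Properties as PermSetoid
open import Data.Nat using (ℕ; zero; suc; _<_; _≤_; _∸_; _⊔_; _<ᵇ_; z≤n; s≤s)
open import Data.Nat.Properties
open import Data.Product using (Σ; _×_; _,_; proj₁; proj₂)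
open import Data.Sum using (_⊎_; inj₁; inj₂)
open import Relation.Binary.Definitions using (tri<; tri≈; tri>)
open import Data.Empty using (⊥; ⊥-elim)
open import Relation.Binary.PropositionalEquality
  using (_≡_; _≢_; refl; sym; trans; cong; subst; setoid; module ≡-Reasoning)
open import Relation.Nullary using (¬_; ¬?; yes; no)
open import Relation.Nullary.Decidable using (dec-true; dec-false)
open import Relation.Nullary.Reflects using (Reflects; ofʸ; ofⁿ)

-- The proof factors the composite through three classical facts:
--   (1) Queue sorting: π contains 4312 iff Q(π) contains 312.  If d c a b is a 4312,
--       then after d is read the most recent queue element is at least d, so every later
--       smaller letter is emitted the moment it is read: c a b survives in Q(π).
--       Conversely, if c a b is a 312 of Q(π), look at the step (reading s) that emits c:
--       it is a draining step, so s ≥ c and s is below the most recent queue element d;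
--       a and b are read after s and, being below d, in the same order; d s a b is a 4312.
--   (2) Reverse-complement exchanges the patterns 312 and 231.
--   (3) Knuth: stack sorting sorts a permutation iff it avoids 231.
-- Queue sorting is analysed through `run`, a step-by-step reformulation of `queueStep`.

Increasing : List ℕ → Set
Increasing = AllPairs _<_

⊆-++-split : ∀ (L : List ℕ) {M xs} → xs ⊆ L ++ M →
  Σ (List ℕ) λ xs₁ → Σ (List ℕ) λ xs₂ → (xs ≡ xs₁ ++ xs₂) × (xs₁ ⊆ L) × (xs₂ ⊆ M)
⊆-++-split []      p          = [] , _ , refl , [] , p
⊆-++-split (y ∷ L) (.y ∷ʳ p) with ⊆-++-split L p
... | xs₁ , xs₂ , refl , p₁ , p₂ = xs₁ , xs₂ , refl , y ∷ʳ p₁ , p₂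
⊆-++-split (y ∷ L) (refl ∷ p) with ⊆-++-split L p
... | xs₁ , xs₂ , refl , p₁ , p₂ = y ∷ xs₁ , xs₂ , refl , refl ∷ p₁ , p₂

AllPairs-resp-⊆ : ∀ {R : ℕ → ℕ → Set} {xs ys} → xs ⊆ ys → AllPairs R ys → AllPairs R xs
AllPairs-resp-⊆ []         ap       = ap
AllPairs-resp-⊆ (y ∷ʳ p)   (_ ∷ ap) = AllPairs-resp-⊆ p ap
AllPairs-resp-⊆ (refl ∷ p) (r ∷ ap) = All-resp-⊆ p r ∷ AllPairs-resp-⊆ p ap

Increasing-pair : ∀ {a b xs L} → Increasing L → a ∷ b ∷ xs ⊆ L → a < b
Increasing-pair inc p with AllPairs-resp-⊆ p inc
... | (a<b ∷ _) ∷ _ = a<b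

Increasing-++ : ∀ {xs ys} → Increasing xs → Increasing ys →
  (∀ {x y} → x ∈ xs → y ∈ ys → x < y) → Increasing (xs ++ ys)
Increasing-++ incx incy cross =
  AllPairs.++⁺ incx incy (All.tabulate λ x∈ → All.tabulate λ y∈ → cross x∈ y∈)

increasing-↭⇒≡ : ∀ {xs ys} → Increasing xs → Increasing ys → xs ↭ ys → xs ≡ ys
increasing-↭⇒≡ incx incy p = Pointwise-≡⇒≡
  (↗↭↗⇒≋ ≤-totalOrder (toSorted incx) (toSorted incy) (↭⇒↭ₛ p))
  where
  toSorted : ∀ {xs} → Increasing xs → Sorted ≤-totalOrder xs
  toSorted inc = Linked.map <⇒≤ (AllPairs⇒Linked inc)

Unique-resp-↭ : ∀ {xs ys : List ℕ} → xs ↭ ys → Unique xs → Unique ys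
Unique-resp-↭ p = PermSetoid.Unique-resp-↭ (setoid ℕ) (↭⇒↭ₛ p)

Unique-suffix : ∀ xs {ys : List ℕ} → Unique (xs ++ ys) → Unique ys
Unique-suffix xs = AllPairs-resp-⊆ (++⁺ˡ xs ⊆-refl)

Unique-disjoint : ∀ xs {ys : List ℕ} {x} → Unique (xs ++ ys) → x ∈ xs → x ∈ ys → ⊥
Unique-disjoint (z ∷ xs) (z≢ ∷ _) (here refl) x∈ys = All.lookup z≢ (∈-++⁺ʳ xs x∈ys) refl
Unique-disjoint (z ∷ xs) (_ ∷ u)  (there x∈xs) x∈ys = Unique-disjoint xs u x∈xs x∈ys

pair-order : ∀ {x y : ℕ} {L} → x ∈ L → y ∈ L → x ≢ y → (x ∷ y ∷ [] ⊆ L) ⊎ (y ∷ x ∷ [] ⊆ L)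
pair-order (here refl)  (here refl)  x≢y = ⊥-elim (x≢y refl)
pair-order (here refl)  (there y∈)   _   = inj₁ (refl ∷ from∈ y∈)
pair-order (there x∈)   (here refl)  _   = inj₂ (refl ∷ from∈ x∈)
pair-order {L = z ∷ _} (there x∈) (there y∈) x≢y with pair-order x∈ y∈ x≢y
... | inj₁ p = inj₁ (z ∷ʳ p)
... | inj₂ p = inj₂ (z ∷ʳ p)

Unique-pair : ∀ {a b : ℕ} {L} → Unique L → a ∷ b ∷ [] ⊆ L → b ∷ a ∷ [] ⊆ L → a ≡ b
Unique-pair (_ ∷ u)  (z ∷ʳ p)   (.z ∷ʳ p′)  = Unique-pair u p p′
Unique-pair (z≢ ∷ _) (z ∷ʳ p)   (refl ∷ p′) = ⊥-elim (All.lookup z≢ (to∈ (∷ˡ⁻ p)) refl)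
Unique-pair (z≢ ∷ _) (refl ∷ p) (_ ∷ʳ p′)   = ⊥-elim (All.lookup z≢ (to∈ (∷ˡ⁻ p′)) refl)
Unique-pair _        (refl ∷ _) (refl ∷ _)  = refl

⊆-map⁻ : ∀ (f : ℕ → ℕ) {xs} L → xs ⊆ map f L → Σ (List ℕ) λ ys → (ys ⊆ L) × (map f ys ≡ xs)
⊆-map⁻ f []      []         = [] , [] , refl
⊆-map⁻ f (w ∷ L) (_ ∷ʳ p)   with ⊆-map⁻ f L p
... | ys , ys⊆ , refl = ys , w ∷ʳ ys⊆ , refl
⊆-map⁻ f (w ∷ L) (refl ∷ p) with ⊆-map⁻ f L p
... | ys , ys⊆ , refl = w ∷ ys , refl ∷ ys⊆ , refl

data Has4312 (σ : List ℕ) : Set where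
  4312-at : ∀ {a b c d} → d ∷ c ∷ a ∷ b ∷ [] ⊆ σ → a < b → b < c → c < d → Has4312 σ

data Has312 (σ : List ℕ) : Set where
  312-at : ∀ {a b c} → c ∷ a ∷ b ∷ [] ⊆ σ → a < b → b < c → Has312 σ

data Has231 (σ : List ℕ) : Set where
  231-at : ∀ {a b c} → b ∷ c ∷ a ∷ [] ⊆ σ → a < b → b < c → Has231 σ

rank : ℕ → List ℕ → ℕ
rank x σ = length (filter (_<? x) σ)

rank-mono : ∀ σ {x y} → y ≤ x → rank y σ ≤ rank x σ
rank-mono σ {x} {y} y≤x =
  length-mono-≤ (filter⁺ (_<? y) (_<? x) (λ { refl z<y → <-≤-trans z<y y≤x }) (⊆-refl {x = σ}))

rank-reflects-< : ∀ σ {x y} → rank y σ < rank x σ → y < x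
rank-reflects-< σ lt = ≰⇒> λ x≤y → <⇒≱ lt (rank-mono σ x≤y)

pattern4312-ranks : ∀ {w x y z : ℕ} → suc w ∷ suc x ∷ suc y ∷ suc z ∷ [] ≡ pattern4312 →
  (w ≡ 3) × (x ≡ 2) × (y ≡ 0) × (z ≡ 1)
pattern4312-ranks refl = refl , refl , refl , refl

contains⇒has4312 : ∀ {π} → Contains pattern4312 π → Has4312 π
contains⇒has4312 (d ∷ c ∷ a ∷ b ∷ [] , dcab⊆ , red≡) with pattern4312-ranks red≡
... | rd , rc , ra , rb = 4312-at dcab⊆ (ordered ra rb 0<1) (ordered rb rc 1<2) (ordered rc rd 2<3)
  where
  σ = d ∷ c ∷ a ∷ b ∷ []
  ordered : ∀ {u v i j} → rank u σ ≡ i → rank v σ ≡ j → i < j → u < v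
  ordered refl refl i<j = rank-reflects-< σ i<j
  0<1 = s≤s z≤n
  1<2 = s≤s 0<1
  2<3 = s≤s 1<2
contains⇒has4312 ([] , _ , ())
contains⇒has4312 (_ ∷ [] , _ , ())
contains⇒has4312 (_ ∷ _ ∷ [] , _ , ())
contains⇒has4312 (_ ∷ _ ∷ _ ∷ [] , _ , ())
contains⇒has4312 (_ ∷ _ ∷ _ ∷ _ ∷ _ ∷ _ , _ , ())

has4312⇒contains : ∀ {π} → Has4312 π → Contains pattern4312 π
has4312⇒contains (4312-at dcab⊆ a<b b<c c<d) =
  _ , dcab⊆ , reduce a<b b<c c<d (<-trans a<b b<c) (<-trans b<c c<d) (<-trans (<-trans a<b b<c) c<d)
  where
  reduce : ∀ {a b c d} → a < b → b < c → c < d → a < c → b < d → a < d →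
           red (d ∷ c ∷ a ∷ b ∷ []) ≡ pattern4312
  reduce {a} {b} {c} {d} ab bc cd ac bd ad
    rewrite dec-false (d <? d) (<-irrefl refl) | dec-true (c <? d) cd
          | dec-true (a <? d) ad               | dec-true (b <? d) bd
          | dec-false (d <? c) (<-asym cd)     | dec-false (c <? c) (<-irrefl refl)
          | dec-true (a <? c) ac               | dec-true (b <? c) bc
          | dec-false (d <? a) (<-asym ad)     | dec-false (c <? a) (<-asym ac)
          | dec-false (a <? a) (<-irrefl refl) | dec-false (b <? a) (<-asym ab)
          | dec-false (d <? b) (<-asym bd)     | dec-false (c <? b) (<-asym bc)
          | dec-true (a <? b) ab               | dec-false (b <? b) (<-irrefl refl)
    = refl

idPerm-increasing : ∀ n → Increasing (idPerm n)
idPerm-increasing n =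
  subst Increasing (sym (map-upTo suc n)) (AllPairs.applyUpTo⁺₁ suc n (λ i<j _ → s≤s i<j))

idPerm-bounded : ∀ {x} n → x ∈ idPerm n → x ≤ n
idPerm-bounded n x∈ with ∈-map⁻ suc x∈
... | _ , i∈ , refl = ∈-upTo⁻ i∈

idPerm-unique : ∀ n → Unique (idPerm n)
idPerm-unique n = AllPairs.map <⇒≢ (idPerm-increasing n)

isPerm-unique : ∀ σ → IsPerm σ → Unique σ
isPerm-unique σ isPerm = Unique-resp-↭ (↭-sym isPerm) (idPerm-unique (length σ))

isPerm-bounded : ∀ σ {x} → IsPerm σ → x ∈ σ → x ≤ length σ
isPerm-bounded σ isPerm x∈ = idPerm-bounded (length σ) (Perm.∈-resp-↭ isPerm x∈)

comp-idPerm : ∀ n → map (suc n ∸_) (idPerm n) ≡ reverse (idPerm n)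
comp-idPerm zero    = refl
comp-idPerm (suc n) = begin
  map (suc (suc n) ∸_) (idPerm (suc n))
    ≡⟨ cong (λ L → map (suc (suc n) ∸_) (1 ∷ map suc L)) (sym (map-upTo suc n)) ⟩
  suc n ∷ map (suc (suc n) ∸_) (map suc (idPerm n)) ≡⟨ cong (suc n ∷_) (sym (map-∘ (idPerm n))) ⟩
  suc n ∷ map (suc n ∸_) (idPerm n)               ≡⟨ cong (suc n ∷_) (comp-idPerm n) ⟩
  suc n ∷ reverse (idPerm n)                      ≡⟨ sym (reverse-++ (idPerm n) (suc n ∷ [])) ⟩
  reverse (idPerm n ++ suc n ∷ [])                ≡⟨ cong reverse (sym (idPerm-snoc n)) ⟩
  reverse (idPerm (suc n))                        ∎
  where
  open ≡-Reasoning
  idPerm-snoc : ∀ n → idPerm (suc n) ≡ idPerm n ++ suc n ∷ []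
  idPerm-snoc n = trans (cong (map suc) (sym (upTo-∷ʳ n))) (map-++ suc (upTo n) (n ∷ []))

rc-perm : ∀ σ → IsPerm σ → rev (comp σ) ↭ idPerm (length σ)
rc-perm σ isPerm = begin
  reverse (map (suc n ∸_) σ)          ↭⟨ Perm.↭-reverse (map (suc n ∸_) σ) ⟩
  map (suc n ∸_) σ                    ↭⟨ Perm.map⁺ (suc n ∸_) isPerm ⟩
  map (suc n ∸_) (idPerm n)           ≡⟨ comp-idPerm n ⟩
  reverse (idPerm n)                  ↭⟨ Perm.↭-reverse (idPerm n) ⟩
  idPerm n                            ∎
  where
  open PermutationReasoning
  n = length σ

-- Complementing x ↦ k ∸ x reflects strict order; preserving it reversed (∸-monoʳ-<)
-- additionally needs the letters to be at most k.
∸-reflects-< : ∀ k {u v} → k ∸ u < k ∸ v → v < u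
∸-reflects-< k lt = ≰⇒> λ u≤v → <⇒≱ lt (∸-monoʳ-≤ k u≤v)

rc-231⇒312 : ∀ σ → Has231 (rev (comp σ)) → Has312 σ
rc-231⇒312 σ (231-at bca⊆ a<b b<c)
  with ⊆-map⁻ (suc (length σ) ∸_) σ
         (subst (_ ⊆_) (reverse-involutive (comp σ)) (reverse⁺ bca⊆))
... | _ ∷ _ ∷ _ ∷ [] , cab⊆σ , refl =
  312-at cab⊆σ (∸-reflects-< (suc (length σ)) b<c) (∸-reflects-< (suc (length σ)) a<b)

rc-312⇒231 : ∀ σ → (∀ {x} → x ∈ σ → x ≤ length σ) → Has312 σ → Has231 (rev (comp σ))
rc-312⇒231 σ bounded (312-at cab⊆ a<b b<c) =
  231-at (reverse⁺ (map⁺ (suc (length σ) ∸_) cab⊆))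
    (∸-monoʳ-< b<c (m≤n⇒m≤1+n c≤)) (∸-monoʳ-< a<b (m≤n⇒m≤1+n b≤))
  where
  c≤ = bounded (to∈ cab⊆)
  b≤ = bounded (to∈ (∷ˡ⁻ (∷ˡ⁻ cab⊆)))

avoid231-⊆ : ∀ {xs ys} → xs ⊆ ys → ¬ Has231 ys → ¬ Has231 xs
avoid231-⊆ xs⊆ avoid (231-at bca⊆ a<b b<c) = avoid (231-at (⊆-trans bca⊆ xs⊆) a<b b<c)

maxL-ub : ∀ {x} L → x ∈ L → x ≤ maxL L
maxL-ub (z ∷ zs) (here refl) = m≤m⊔n z (maxL zs)
maxL-ub (z ∷ zs) (there x∈) = ≤-trans (maxL-ub zs x∈) (m≤n⊔m z (maxL zs))

maxL-∈ : ∀ z zs → maxL (z ∷ zs) ∈ z ∷ zs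
maxL-∈ z []       = here (⊔-identityʳ z)
maxL-∈ z (w ∷ ws) with ⊔-sel z (maxL (w ∷ ws))
... | inj₁ max≡z = here max≡z
... | inj₂ max≡ = there (subst (_∈ w ∷ ws) (sym max≡) (maxL-∈ w ws))

span-at : ∀ m L → m ∈ L → Σ (List ℕ) λ α → Σ (List ℕ) λ β →
  (span (λ y → ¬? (y ≟ m)) L ≡ (α , m ∷ β)) × (L ≡ α ++ m ∷ β)
span-at m (z ∷ zs) m∈ with z ≟ m
... | yes refl rewrite dec-false (¬? (z ≟ z)) (λ z≢z → z≢z refl) = [] , zs , refl , refl
... | no z≢m rewrite dec-true (¬? (z ≟ m)) z≢m with span-at m zs (Any.tail (λ m≡z → z≢m (sym m≡z)) m∈)
...   | α , β , span≡ , zs≡ rewrite span≡ = z ∷ α , β , refl , cong (z ∷_) zs≡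

split-lengths : ∀ α (m : ℕ) β k → length (α ++ m ∷ β) ≤ suc k → (length α ≤ k) × (length β ≤ k)
split-lengths α m β k le rewrite length-++ α {m ∷ β} | +-suc (length α) (length β) =
  ≤-trans (m≤m+n (length α) (length β)) (≤-pred le) , ≤-trans (m≤n+m (length β) (length α)) (≤-pred le)

record MaxSplit (k : ℕ) (σ : List ℕ) : Set where
  field
    α β   : List ℕ
    σ≡    : σ ≡ α ++ maxL σ ∷ β
    sort≡ : stackSortF (suc k) σ ≡ stackSortF k α ++ stackSortF k β ++ maxL σ ∷ []
    |α|≤  : length α ≤ k
    |β|≤  : length β ≤ k

max-split : ∀ k x xs → length (x ∷ xs) ≤ suc k → MaxSplit k (x ∷ xs)
max-split k x xs le with span-at (maxL (x ∷ xs)) (x ∷ xs) (maxL-∈ x xs)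
... | α , β , span≡ , σ≡ = record
  { α = α ; β = β ; σ≡ = σ≡ ; sort≡ = sort≡
  ; |α|≤ = proj₁ lengths ; |β|≤ = proj₂ lengths }
  where
  sort≡ : stackSortF (suc k) (x ∷ xs) ≡ stackSortF k α ++ stackSortF k β ++ maxL (x ∷ xs) ∷ []
  sort≡ rewrite span≡ = refl
  lengths = split-lengths α (maxL (x ∷ xs)) β k (subst (λ L → length L ≤ suc k) σ≡ le)

stackSortF-perm : ∀ k σ → length σ ≤ k → stackSortF k σ ↭ σ
stackSortF-perm zero    []       _  = ↭-refl
stackSortF-perm (suc k) []       _  = ↭-refl
stackSortF-perm (suc k) (x ∷ xs) le = begin
  stackSortF (suc k) (x ∷ xs)                ≡⟨ sort≡ ⟩
  stackSortF k α ++ stackSortF k β ++ m ∷ []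
    ↭⟨ Perm.++⁺ (stackSortF-perm k α |α|≤) (Perm.++⁺ʳ (m ∷ []) (stackSortF-perm k β |β|≤)) ⟩
  α ++ β ++ m ∷ []                           ↭⟨ Perm.++⁺ˡ α (↭-sym (Perm.∷↭∷ʳ m β)) ⟩
  α ++ m ∷ β                                 ≡⟨ sym σ≡ ⟩
  x ∷ xs                                     ∎
  where
  open PermutationReasoning
  open MaxSplit (max-split k x xs le)
  m = maxL (x ∷ xs)

stackSortF-231 : ∀ k σ {a b c} → length σ ≤ k → b ∷ c ∷ a ∷ [] ⊆ σ → a < b → b < c →
  b ∷ a ∷ [] ⊆ stackSortF k σ
stackSortF-231 (suc k) (x ∷ xs) {a} {b} {c} le bca⊆ a<b b<c =
  subst (b ∷ a ∷ [] ⊆_) (sym sort≡) (by-position (⊆-++-split α (subst (_ ⊆_) σ≡ bca⊆)))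
  where
  open MaxSplit (max-split k x xs le)
  m = maxL (x ∷ xs)
  ≤m : ∀ {z} → z ∈ α ++ m ∷ β → z ≤ m
  ≤m z∈ = maxL-ub (x ∷ xs) (subst (_ ∈_) (sym σ≡) z∈)
  sorted-α : ∀ {z} → z ∈ α → z ∈ stackSortF k α
  sorted-α z∈ = Perm.∈-resp-↭ (↭-sym (stackSortF-perm k α |α|≤)) z∈
  sorted-β : ∀ {z} → z ∈ β → z ∈ stackSortF k β
  sorted-β z∈ = Perm.∈-resp-↭ (↭-sym (stackSortF-perm k β |β|≤)) z∈
  across : b ∈ α → a ∈ β → b ∷ a ∷ [] ⊆ stackSortF k α ++ stackSortF k β ++ m ∷ []
  across b∈ a∈ = ++⁺ (from∈ (sorted-α b∈)) (++⁺ʳ (m ∷ []) (from∈ (sorted-β a∈)))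
  by-position : Σ (List ℕ) (λ xs₁ → Σ (List ℕ) λ xs₂ →
      (b ∷ c ∷ a ∷ [] ≡ xs₁ ++ xs₂) × (xs₁ ⊆ α) × (xs₂ ⊆ m ∷ β)) →
    b ∷ a ∷ [] ⊆ stackSortF k α ++ stackSortF k β ++ m ∷ []
  by-position ([] , _ , refl , _ , (refl ∷ ca⊆β)) =
    ⊥-elim (<⇒≱ b<c (≤m (∈-++⁺ʳ α (there (to∈ ca⊆β)))))
  by-position ([] , _ , refl , _ , (.m ∷ʳ bca⊆β)) =
    ++⁺ˡ (stackSortF k α) (++⁺ʳ (m ∷ []) (stackSortF-231 k β |β|≤ bca⊆β a<b b<c))
  by-position (_ ∷ [] , _ , refl , b⊆α , (refl ∷ a⊆β)) = across (to∈ b⊆α) (to∈ a⊆β)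
  by-position (_ ∷ [] , _ , refl , b⊆α , (.m ∷ʳ ca⊆β)) = across (to∈ b⊆α) (to∈ (∷ˡ⁻ ca⊆β))
  by-position (_ ∷ _ ∷ [] , _ , refl , bc⊆α , (refl ∷ _)) =
    ⊥-elim (<⇒≱ (<-trans a<b b<c) (≤m (∈-++⁺ˡ (to∈ (∷ˡ⁻ bc⊆α)))))
  by-position (_ ∷ _ ∷ [] , _ , refl , b⊆α , (.m ∷ʳ a⊆β)) = across (to∈ b⊆α) (to∈ a⊆β)
  by-position (_ ∷ _ ∷ _ ∷ [] , _ , refl , bca⊆α , _) =
    ++⁺ʳ (stackSortF k β ++ m ∷ []) (stackSortF-231 k α |α|≤ bca⊆α a<b b<c)
  by-position (_ ∷ _ ∷ _ ∷ _ ∷ _ , _ , () , _ , _)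

-- Fact (3), Knuth: stack sorting sorts every 231-avoiding list of distinct letters.  Letters of α are
-- below those of β (otherwise α-letter, m, β-letter would be a 231) and all are below m.
stackSortF-sorts : ∀ k σ → length σ ≤ k → Unique σ → ¬ Has231 σ → Increasing (stackSortF k σ)
stackSortF-sorts zero    []       _  _ _     = []
stackSortF-sorts (suc k) []       _  _ _     = []
stackSortF-sorts (suc k) (x ∷ xs) le u avoid =
  subst Increasing (sym sort≡)
    (Increasing-++ (stackSortF-sorts k α |α|≤ uα avoid-α)
      (Increasing-++ (stackSortF-sorts k β |β|≤ uβ avoid-β) ([] ∷ [])
        λ { w∈ (here refl) → β<m (from-β w∈) })
      λ z∈ w∈ → below-rest (from-α z∈) (∈-++⁻ (stackSortF k β) w∈))
  where
  open MaxSplit (max-split k x xs le)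
  m = maxL (x ∷ xs)
  u′ : Unique (α ++ m ∷ β)
  u′ = subst Unique σ≡ u
  uα = AllPairs-resp-⊆ (++⁺ʳ (m ∷ β) ⊆-refl) u′
  uβ = AllPairs-resp-⊆ (++⁺ˡ α (m ∷ʳ ⊆-refl)) u′
  avoid′ : ¬ Has231 (α ++ m ∷ β)
  avoid′ = subst (λ L → ¬ Has231 L) σ≡ avoid
  avoid-α = avoid231-⊆ (++⁺ʳ (m ∷ β) ⊆-refl) avoid′
  avoid-β = avoid231-⊆ (++⁺ˡ α (m ∷ʳ ⊆-refl)) avoid′
  from-α : ∀ {z} → z ∈ stackSortF k α → z ∈ α
  from-α = Perm.∈-resp-↭ (stackSortF-perm k α |α|≤)
  from-β : ∀ {z} → z ∈ stackSortF k β → z ∈ β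
  from-β = Perm.∈-resp-↭ (stackSortF-perm k β |β|≤)
  ≤m : ∀ {z} → z ∈ α ++ m ∷ β → z ≤ m
  ≤m z∈ = maxL-ub (x ∷ xs) (subst (_ ∈_) (sym σ≡) z∈)
  α<m : ∀ {z} → z ∈ α → z < m
  α<m z∈ = ≤∧≢⇒< (≤m (∈-++⁺ˡ z∈)) λ { refl → Unique-disjoint α u′ z∈ (here refl) }
  β<m : ∀ {z} → z ∈ β → z < m
  β<m z∈ = ≤∧≢⇒< (≤m (∈-++⁺ʳ α (there z∈)))
             λ { refl → Unique[x∷xs]⇒x∉xs (Unique-suffix α u′) z∈ }
  below-rest : ∀ {z w} → z ∈ α → w ∈ stackSortF k β ⊎ w ∈ m ∷ [] → z < w
  below-rest z∈ (inj₂ (here refl)) = α<m z∈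
  below-rest {z} {w} z∈ (inj₁ w∈) with <-cmp z w
  ... | tri< z<w _ _ = z<w
  ... | tri≈ _ refl _ = ⊥-elim (Unique-disjoint α u′ z∈ (there (from-β w∈)))
  ... | tri> _ _ w<z = ⊥-elim (avoid′ (231-at (++⁺ (from∈ z∈) (refl ∷ from∈ (from-β w∈))) w<z (α<m z∈)))

S-perm : ∀ σ → S σ ↭ σ
S-perm σ = stackSortF-perm (length σ) σ ≤-refl

S-sorts : ∀ {σ} → Unique σ → ¬ Has231 σ → Increasing (S σ)
S-sorts {σ} = stackSortF-sorts (length σ) σ ≤-refl

S-231-unsorted : ∀ {σ} → Has231 σ → ¬ Increasing (S σ)
S-231-unsorted {σ} (231-at bca⊆ a<b b<c) inc =
  <-asym a<b (Increasing-pair inc (stackSortF-231 (length σ) σ ≤-refl bca⊆ a<b b<c))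

-- The queue is a list in insertion order; `back q` is its most recent element (0 if empty).
back : List ℕ → ℕ
back []           = 0
back (y ∷ [])     = y
back (y ∷ z ∷ ys) = back (z ∷ ys)

back-∈ : ∀ y ys → back (y ∷ ys) ∈ y ∷ ys
back-∈ y []       = here refl
back-∈ y (z ∷ ys) = there (back-∈ z ys)

back-snoc : ∀ q s → back (q ++ s ∷ []) ≡ s
back-snoc []           s = refl
back-snoc (y ∷ [])     s = refl
back-snoc (y ∷ z ∷ ys) s = back-snoc (z ∷ ys) s

back-max : ∀ {q} → Increasing q → All (_≤ back q) q
back-max {[]}         []       = []
back-max {y ∷ []}     _        = ≤-refl ∷ []
back-max {y ∷ z ∷ ys} (y< ∷ inc) = <⇒≤ (All.lookup y< (back-∈ z ys)) ∷ back-max inc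

lastLt-reflects : ∀ y ys s → Reflects (back (y ∷ ys) < s) (lastLt (y ∷ ys) s)
lastLt-reflects y []       s = <ᵇ-reflects-< y s
lastLt-reflects y (z ∷ ys) s = lastLt-reflects z ys s

drain-split : ∀ q s → proj₁ (drain q s) ++ proj₂ (drain q s) ≡ q
drain-split []       s = refl
drain-split (y ∷ ys) s with y <ᵇ s | <ᵇ-reflects-< y s
... | false | ofⁿ _ = refl
... | true  | ofʸ _ = cong (y ∷_) (drain-split ys s)

drain-below : ∀ q s → All (_< s) (proj₁ (drain q s))
drain-below []       s = []
drain-below (y ∷ ys) s with y <ᵇ s | <ᵇ-reflects-< y s
... | false | ofⁿ _   = []
... | true  | ofʸ y<s = y<s ∷ drain-below ys s

drain-rest-above : ∀ {q} s → Increasing q → All (s ≤_) (proj₂ (drain q s))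
drain-rest-above {[]}     s _            = []
drain-rest-above {y ∷ ys} s (y< ∷ inc) with y <ᵇ s | <ᵇ-reflects-< y s
... | true  | ofʸ _   = drain-rest-above s inc
... | false | ofⁿ y≮s = ≮⇒≥ y≮s ∷ All.map (λ y<z → <⇒≤ (≤-<-trans (≮⇒≥ y≮s) y<z)) y<

drain-keeps-back : ∀ q s → s ≤ back q → back (proj₂ (drain q s)) ≡ back q
drain-keeps-back []       s _ = refl
drain-keeps-back (y ∷ ys) s s≤ with y <ᵇ s | <ᵇ-reflects-< y s
... | false | ofⁿ _   = refl
... | true  | ofʸ y<s with ys
...   | []     = ⊥-elim (<-irrefl refl (<-≤-trans y<s s≤))
...   | z ∷ zs = drain-keeps-back (z ∷ zs) s s≤

drain-out-⊆ : ∀ q s → proj₁ (drain q s) ⊆ q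
drain-out-⊆ q s = subst (proj₁ (drain q s) ⊆_) (drain-split q s) (++⁺ʳ (proj₂ (drain q s)) ⊆-refl)

drain-rest-⊆ : ∀ q s → proj₂ (drain q s) ⊆ q
drain-rest-⊆ q s = subst (proj₂ (drain q s) ⊆_) (drain-split q s) (++⁺ˡ (proj₁ (drain q s)) ⊆-refl)

step : List ℕ → ℕ → List ℕ × List ℕ
step []       s = [] , s ∷ []
step (y ∷ ys) s with lastLt (y ∷ ys) s
... | true  = [] , (y ∷ ys) ++ s ∷ []
... | false = proj₁ (drain (y ∷ ys) s) ++ s ∷ [] , proj₂ (drain (y ∷ ys) s)

emit : List ℕ → ℕ → List ℕ
emit q s = proj₁ (step q s)

next : List ℕ → ℕ → List ℕ
next q s = proj₂ (step q s)

step-perm : ∀ q s → emit q s ++ next q s ↭ q ++ s ∷ []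
step-perm []       s = ↭-refl
step-perm (y ∷ ys) s with lastLt (y ∷ ys) s
... | true  = ↭-refl
... | false = begin
    (out ++ s ∷ []) ++ rest  ≡⟨ ++-assoc out (s ∷ []) rest ⟩
    out ++ s ∷ rest          ↭⟨ Perm.++⁺ˡ out (Perm.∷↭∷ʳ s rest) ⟩
    out ++ rest ++ s ∷ []    ≡⟨ sym (++-assoc out rest (s ∷ [])) ⟩
    (out ++ rest) ++ s ∷ []  ≡⟨ cong (_++ s ∷ []) (drain-split (y ∷ ys) s) ⟩
    (y ∷ ys) ++ s ∷ []       ∎
  where
  open PermutationReasoning
  out = proj₁ (drain (y ∷ ys) s)
  rest = proj₂ (drain (y ∷ ys) s)

-- The most recent queue element only grows: it is the largest letter read so far.
step-back : ∀ q s → back (next q s) ≡ back q ⊔ s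
step-back []       s = refl
step-back (y ∷ ys) s with lastLt (y ∷ ys) s | lastLt-reflects y ys s
... | true  | ofʸ b<s = trans (back-snoc (y ∷ ys) s) (sym (m≤n⇒m⊔n≡n (<⇒≤ b<s)))
... | false | ofⁿ b≮s = trans (drain-keeps-back (y ∷ ys) s (≮⇒≥ b≮s)) (sym (m≥n⇒m⊔n≡m (≮⇒≥ b≮s)))

back-grows : ∀ q s → back q ≤ back (next q s)
back-grows q s = subst (back q ≤_) (sym (step-back q s)) (m≤m⊔n (back q) s)

back-next-≥ : ∀ q s → s ≤ back (next q s)
back-next-≥ q s = subst (s ≤_) (sym (step-back q s)) (m≤n⊔m (back q) s)

step-emits-small : ∀ q s → s < back q → Σ (List ℕ) λ out → emit q s ≡ out ++ s ∷ []
step-emits-small (y ∷ ys) s s<b with lastLt (y ∷ ys) s | lastLt-reflects y ys s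
... | true  | ofʸ b<s = ⊥-elim (<-asym s<b b<s)
... | false | ofⁿ _   = proj₁ (drain (y ∷ ys) s) , refl

step-increasing : ∀ {q} s → Increasing q → Increasing (emit q s) × Increasing (next q s)
step-increasing {[]}     s _   = [] , [] ∷ []
step-increasing {y ∷ ys} s inc with lastLt (y ∷ ys) s | lastLt-reflects y ys s
... | true  | ofʸ b<s =
  [] , Increasing-++ inc ([] ∷ []) λ x∈ → λ { (here refl) → ≤-<-trans (All.lookup (back-max inc) x∈) b<s }
... | false | ofⁿ _   =
  Increasing-++ (AllPairs-resp-⊆ (drain-out-⊆ (y ∷ ys) s) inc) ([] ∷ [])
    (λ x∈ → λ { (here refl) → All.lookup (drain-below (y ∷ ys) s) x∈ }) ,
  AllPairs-resp-⊆ (drain-rest-⊆ (y ∷ ys) s) inc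

-- What we know about a step from queue q on letter s, leading to queue q′, that emits c:
-- it is a draining step, so s does not exceed the most recent element of q.
record Emitting (q : List ℕ) (s c : ℕ) (q′ : List ℕ) : Set where
  field
    c≤s    : c ≤ s
    s≤back : s ≤ back q
    back∈q : back q ∈ q
    q′≥s   : All (s ≤_) q′

step-emitting : ∀ {q s c} → Increasing q → c ∈ emit q s → Emitting q s c (next q s)
step-emitting {y ∷ ys} {s} inc c∈ with lastLt (y ∷ ys) s | lastLt-reflects y ys s
... | false | ofⁿ b≮s = record
  { c≤s    = c≤s (∈-++⁻ (proj₁ (drain (y ∷ ys) s)) c∈)
  ; s≤back = ≮⇒≥ b≮s
  ; back∈q = back-∈ y ys
  ; q′≥s   = drain-rest-above s inc
  }
  where
  c≤s : ∀ {c} → c ∈ proj₁ (drain (y ∷ ys) s) ⊎ c ∈ s ∷ [] → c ≤ s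
  c≤s (inj₁ c∈out)       = <⇒≤ (All.lookup (drain-below (y ∷ ys) s) c∈out)
  c≤s (inj₂ (here refl)) = ≤-refl

run : List ℕ → List ℕ → List ℕ
run q []       = q
run q (s ∷ ss) = emit q s ++ run (next q s) ss

queueStep≡run : ∀ q out rest → queueStep q out rest ≡ out ++ run q rest
queueStep≡run q        out []       = refl
queueStep≡run []       out (s ∷ ss) = queueStep≡run (s ∷ []) out ss
queueStep≡run (y ∷ ys) out (s ∷ ss) with lastLt (y ∷ ys) s
... | true  = queueStep≡run ((y ∷ ys) ++ s ∷ []) out ss
... | false with drain (y ∷ ys) s
...   | out′ , rest = begin
  queueStep rest (out ++ out′ ++ s ∷ []) ss   ≡⟨ queueStep≡run rest (out ++ out′ ++ s ∷ []) ss ⟩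
  (out ++ out′ ++ s ∷ []) ++ run rest ss      ≡⟨ ++-assoc out (out′ ++ s ∷ []) (run rest ss) ⟩
  out ++ (out′ ++ s ∷ []) ++ run rest ss      ∎
  where open ≡-Reasoning

Q≡run : ∀ π → Q π ≡ run [] π
Q≡run π = queueStep≡run [] [] π

run-perm : ∀ q rest → run q rest ↭ q ++ rest
run-perm q []       = ↭-reflexive (sym (++-identityʳ q))
run-perm q (s ∷ ss) = begin
  emit q s ++ run (next q s) ss     ↭⟨ Perm.++⁺ˡ (emit q s) (run-perm (next q s) ss) ⟩
  emit q s ++ next q s ++ ss        ≡⟨ sym (++-assoc (emit q s) (next q s) ss) ⟩
  (emit q s ++ next q s) ++ ss      ↭⟨ Perm.++⁺ʳ ss (step-perm q s) ⟩
  (q ++ s ∷ []) ++ ss               ≡⟨ ++-assoc q (s ∷ []) ss ⟩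
  q ++ s ∷ ss                       ∎
  where open PermutationReasoning

-- Once the most recent queue element is at least D, every later letter below D is
-- emitted as soon as it is read, so such letters keep their relative order.
run-keeps-below : ∀ {D} q rest {xs} → D ≤ back q → xs ⊆ rest → All (_< D) xs → xs ⊆ run q rest
run-keeps-below q []       D≤ [] [] = minimum q
run-keeps-below q (s ∷ ss) D≤ (.s ∷ʳ p) xs<D =
  ++⁺ˡ (emit q s) (run-keeps-below (next q s) ss (≤-trans D≤ (back-grows q s)) p xs<D)
run-keeps-below q (s ∷ ss) D≤ (refl ∷ p) (s<D ∷ xs<D)
  with step-emits-small q s (<-≤-trans s<D D≤)
... | out , emit≡ = subst (_ ⊆_) (sym rearranged)
        (++⁺ˡ out (refl ∷ run-keeps-below (next q s) ss (≤-trans D≤ (back-grows q s)) p xs<D))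
  where
  open ≡-Reasoning
  rearranged : emit q s ++ run (next q s) ss ≡ out ++ s ∷ run (next q s) ss
  rearranged = begin
    emit q s ++ run (next q s) ss          ≡⟨ cong (_++ run (next q s) ss) emit≡ ⟩
    (out ++ s ∷ []) ++ run (next q s) ss   ≡⟨ ++-assoc out (s ∷ []) (run (next q s) ss) ⟩
    out ++ s ∷ run (next q s) ss           ∎

step-unique : ∀ q s ss → Unique (q ++ s ∷ ss) → Unique (next q s ++ ss)
step-unique q s ss u = Unique-suffix (emit q s)
  (subst Unique (++-assoc (emit q s) (next q s) ss) (Unique-resp-↭ (↭-sym regroup) u))
  where
  open PermutationReasoning
  regroup : (emit q s ++ next q s) ++ ss ↭ q ++ s ∷ ss
  regroup = begin
    (emit q s ++ next q s) ++ ss  ↭⟨ Perm.++⁺ʳ ss (step-perm q s) ⟩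
    (q ++ s ∷ []) ++ ss           ≡⟨ ++-assoc q (s ∷ []) ss ⟩
    q ++ s ∷ ss                   ∎

-- Letters that follow a larger letter d in the input keep their relative order in the output:
-- after d is read the most recent queue element is at least d.
run-keeps-after : ∀ q rest {d xs} → d ∷ xs ⊆ rest → All (_< d) xs → xs ⊆ run q rest
run-keeps-after q (s ∷ ss) (.s ∷ʳ p) xs<d = ++⁺ˡ (emit q s) (run-keeps-after (next q s) ss p xs<d)
run-keeps-after q (s ∷ ss) (refl ∷ p) xs<d =
  ++⁺ˡ (emit q s) (run-keeps-below (next q s) ss (back-next-≥ q s) p xs<d)

run-reflects-below : ∀ q rest {a b} → Unique (q ++ rest) → a ∈ rest → b ∈ rest → a ≢ b →
  a < back q → b < back q → a ∷ b ∷ [] ⊆ run q rest → a ∷ b ∷ [] ⊆ rest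
run-reflects-below q rest u a∈ b∈ a≢b a< b< ab⊆run with pair-order a∈ b∈ a≢b
... | inj₁ ab⊆rest = ab⊆rest
... | inj₂ ba⊆rest = ⊥-elim (a≢b (Unique-pair (Unique-resp-↭ (↭-sym (run-perm q rest)) u) ab⊆run
                       (run-keeps-below q rest ≤-refl ba⊆rest (b< ∷ a< ∷ []))))

-- Here p is the input read so far; the queue q is increasing and drawn from p.
-- Let c be emitted (while reading s) before a and b; then s ≥ c exceeds a and b, both
-- are read after s, and the most recent queue element d > s: so d s a b is a 4312.
run-312⇒4312 : ∀ p q rest {a b c} → Increasing q → (∀ {x} → x ∈ q → x ∈ p) → Unique (q ++ rest) →
  c ∷ a ∷ b ∷ [] ⊆ run q rest → a < b → b < c → Has4312 (p ++ rest)
run-312⇒4312 p q [] inc _ _ cab⊆q a<b b<c =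
  ⊥-elim (<-asym (Increasing-pair inc cab⊆q) (<-trans a<b b<c))
run-312⇒4312 p q (s ∷ ss) {a} {b} {c} inc q⊆p u cab⊆ a<b b<c
  with step-unique q s ss u | ⊆-++-split (emit q s) cab⊆
... | u′ | [] , _ , refl , _ , cab⊆run =
  subst Has4312 (++-assoc p (s ∷ []) ss)
    (run-312⇒4312 (p ++ s ∷ []) (next q s) ss (proj₂ (step-increasing s inc)) next⊆ u′ cab⊆run a<b b<c)
  where
  next⊆ : ∀ {x} → x ∈ next q s → x ∈ p ++ s ∷ []
  next⊆ x∈ with ∈-++⁻ q (Perm.∈-resp-↭ (step-perm q s) (∈-++⁺ʳ (emit q s) x∈))
  ... | inj₁ x∈q = ∈-++⁺ˡ (q⊆p x∈q)
  ... | inj₂ x∈s = ∈-++⁺ʳ p x∈s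
... | u′ | c ∷ [] , _ , refl , c⊆emit , ab⊆run =
  4312-at (++⁺ (from∈ (q⊆p back∈q)) (refl ∷ ab⊆ss)) a<b b<s s<back
  where
  open Emitting (step-emitting {q} {s} {c} inc (to∈ c⊆emit))
  b<s = <-≤-trans b<c c≤s
  a<s = <-trans a<b b<s
  s<back : s < back q
  s<back = ≤∧≢⇒< s≤back λ s≡ → Unique-disjoint q u (subst (_∈ q) (sym s≡) back∈q) (here refl)
  read-later : ∀ {x} → x < s → x ∈ run (next q s) ss → x ∈ ss
  read-later x<s x∈ with ∈-++⁻ (next q s) (Perm.∈-resp-↭ (run-perm (next q s) ss) x∈)
  ... | inj₁ x∈next = ⊥-elim (<⇒≱ x<s (All.lookup q′≥s x∈next))
  ... | inj₂ x∈ss   = x∈ss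
  ab⊆ss : a ∷ b ∷ [] ⊆ ss
  ab⊆ss = run-reflects-below (next q s) ss u′ (read-later a<s (to∈ ab⊆run))
            (read-later b<s (to∈ (∷ˡ⁻ ab⊆run))) (<⇒≢ a<b)
            (<-≤-trans a<s (back-next-≥ q s)) (<-≤-trans b<s (back-next-≥ q s)) ab⊆run
... | _  | c ∷ a ∷ [] , _ , refl , ca⊆emit , _ =
  ⊥-elim (<-asym (Increasing-pair (proj₁ (step-increasing s inc)) ca⊆emit) (<-trans a<b b<c))
... | _  | c ∷ a ∷ b ∷ [] , _ , refl , cab⊆emit , _ =
  ⊥-elim (<-asym (Increasing-pair (proj₁ (step-increasing s inc)) cab⊆emit) (<-trans a<b b<c))
... | _  | _ ∷ _ ∷ _ ∷ _ ∷ _ , _ , () , _ , _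

Q-perm : ∀ π → Q π ↭ π
Q-perm π = subst (_↭ π) (sym (Q≡run π)) (run-perm [] π)

Q-isPerm : ∀ {π} → IsPerm π → IsPerm (Q π)
Q-isPerm {π} isPerm =
  subst (λ k → Q π ↭ idPerm k) (sym (Perm.↭-length (Q-perm π))) (↭-trans (Q-perm π) isPerm)

has4312⇒Q-has312 : ∀ {π} → Has4312 π → Has312 (Q π)
has4312⇒Q-has312 {π} (4312-at dcab⊆ a<b b<c c<d) =
  312-at (subst (_ ⊆_) (sym (Q≡run π)) (run-keeps-after [] π dcab⊆ (c<d ∷ a<d ∷ b<d ∷ []))) a<b b<c
  where
  b<d = <-trans b<c c<d
  a<d = <-trans a<b b<d

Q-has312⇒has4312 : ∀ {π} → Unique π → Has312 (Q π) → Has4312 π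
Q-has312⇒has4312 {π} u (312-at cab⊆ a<b b<c) =
  run-312⇒4312 [] [] π [] (λ ()) u (subst (_ ⊆_) (Q≡run π) cab⊆) a<b b<c

theorem3p3 : (π : List ℕ) → IsPerm π →
    (Avoids pattern4312 π → SrcQ π ≡ idPerm (length π)) × (SrcQ π ≡ idPerm (length π) → Avoids pattern4312 π)
theorem3p3 π isPerm = avoids⇒sorted , sorted⇒avoids
  where
  σ = Q π
  τ = rev (comp σ)
  σ-isPerm = Q-isPerm isPerm
  τ-perm = rc-perm σ σ-isPerm
  |σ|≡ = Perm.↭-length (Q-perm π)
  -- π avoids 4312  ⇔  σ avoids 312  ⇔  τ avoids 231  ⇔  S τ is sorted.
  no231 : Avoids pattern4312 π → ¬ Has231 τ
  no231 avoid h = avoid (has4312⇒contains (Q-has312⇒has4312 (isPerm-unique π isPerm) (rc-231⇒312 σ h)))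
  avoids⇒sorted : Avoids pattern4312 π → SrcQ π ≡ idPerm (length π)
  avoids⇒sorted avoid = subst (λ k → S τ ≡ idPerm k) |σ|≡
    (increasing-↭⇒≡ (S-sorts (Unique-resp-↭ (↭-sym τ-perm) (idPerm-unique (length σ))) (no231 avoid))
      (idPerm-increasing (length σ)) (↭-trans (S-perm τ) τ-perm))
  sorted⇒avoids : SrcQ π ≡ idPerm (length π) → Avoids pattern4312 π
  sorted⇒avoids sorted contains =
    S-231-unsorted (rc-312⇒231 σ (isPerm-bounded σ σ-isPerm) (has4312⇒Q-has312 (contains⇒has4312 contains)))
      (subst Increasing (sym sorted) (idPerm-increasing (length π)))
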